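{- Define polynomials $P_k,Q_k$ by $P_0(t)=Q_0(t)=1$, $P_{k+1}(t)=tP_k(t)+P_k'(t)$ for $k\ge0$, and $Q_k(t)=P_k(t)+Q_{k-1}'(t)$ for $k\ge1$. For $k\ge0$ let $J(k)=\{j:0\le j\le k,\ j\equiv k\pmod 2\}$. Then for every $k=0,1,2,\dots$ there is a unique representation $Q_k(t)=\sum_{j\in J(k)}\beta_{k,j}P_j(t)$, and its coefficients are $\beta_{k,j}=\frac{n!}{j!}$ where $n=\frac{k+j}{2}$, $j\in J(k)$. -}

module Defs where

open import Data.Nat as ℕ using (ℕ; zero; suc; _≤_; _%_; _!)
import Data.Nat.Properties as ℕP
open import Data.Integer using (+_)
open import Data.Rational using (ℚ; 0ℚ; 1ℚ; _+_; _*_; _/_)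
open import Data.List using (List; upTo; filter; map; foldr)
open import Relation.Binary.PropositionalEquality using (_≡_)

-- Polynomials in t with rational coefficients, represented by their
-- coefficient sequence: a polynomial p is the map  i ↦ (coefficient of t^i).
Poly : Set
Poly = ℕ → ℚ

_≈ₚ_ : Poly → Poly → Set
p ≈ₚ q = ∀ i → p i ≡ q i

one : Poly
one zero    = 1ℚ
one (suc i) = 0ℚ

mulT : Poly → Poly
mulT p zero    = 0ℚ
mulT p (suc i) = p i

deriv : Poly → Poly
deriv p i = (+ suc i / 1) * p (suc i)

_⊕_ : Poly → Poly → Poly
(p ⊕ q) i = p i + q i

P : ℕ → Poly
P zero    = one
P (suc k) = mulT (P k) ⊕ deriv (P k)

Q : ℕ → Poly
Q zero    = one
Q (suc k) = P (suc k) ⊕ deriv (Q k)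

InJ : ℕ → ℕ → Set
InJ k j = (j ≤ k) × (j % 2 ≡ k % 2)
  where open import Data.Product using (_×_)

Jlist : ℕ → List ℕ
Jlist k = filter (λ j → j % 2 ℕ.≟ k % 2) (upTo (suc k))

combJ : ℕ → (ℕ → ℚ) → Poly
combJ k β i = foldr (λ j acc → β j * P j i + acc) 0ℚ (Jlist k)

βkj : ℕ → ℕ → ℚ
βkj k j = (+ (((k ℕ.+ j) ℕ./ 2) !) / (j !)) {{j ℕP.!≢0}}

module Submission where

-- The whole computation rests on one property of the P_j: they form an
-- Appell sequence, P_{j+1}' = (j+1) P_j, proved by induction from the
-- recurrence P_{j+1} = t P_j + P_j' using linearity of the derivative and
-- the Leibniz rule (t p)' = p + t p'.  Consequently differentiation acts on
-- a combination Σ_{j∈J(k+1)} β_j P_j by shifting its coefficients,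
-- β ↦ (j ↦ (j+1) β_{j+1}), landing in the span over J(k).
--
-- Existence: by induction, Q_{k+2} = P_{k+2} + Q_{k+1}' is the combination
-- with coefficients (j+1) β_{k+1,j+1} = β_{k+2,j} for j ∈ J(k), plus
-- β_{k+2,k+2} = 1 for the new top index.
-- Uniqueness: P_j is monic of degree j, so a combination over J(k) has
-- degree ≤ k and its coefficient of t^k is β_k; comparing top coefficients
-- and cancelling the top summand reduces J(k+2) to J(k).

open import Defs
open import Data.Nat using (ℕ)
open import Data.Rational using (ℚ)
open import Data.Product using (_×_)
open import Relation.Binary.PropositionalEquality using (_≡_)

open import Data.Nat as ℕ using (zero; suc; _<_; _%_; _!; z≤n; s≤s)
import Data.Nat.Properties as ℕP
open import Data.Nat.DivMod using (m*n/n≡m)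
open import Data.Integer as ℤ using (+_)
import Data.Integer.Properties as ℤP
import Data.Integer.Solver as ℤ-Solver
open import Data.Rational using (0ℚ; 1ℚ; _+_; _*_; _/_; toℚᵘ; fromℚᵘ)
open import Data.Rational.Properties
  using ( toℚᵘ-injective; toℚᵘ-fromℚᵘ; fromℚᵘ-cong; toℚᵘ-homo-+; toℚᵘ-homo-*
        ; +-identityˡ; +-identityʳ; +-assoc; +-comm; *-identityˡ; *-identityʳ; *-zeroʳ; *-assoc
        ; *-distribˡ-+; +-0-group)
import Data.Rational.Solver as ℚ-Solver
import Data.Rational.Unnormalised as U
import Data.Rational.Unnormalised.Properties as UP
open import Algebra.Properties.Group +-0-group using (∙-cancelʳ)
open import Data.List using (List; []; _∷_; [_]; _++_; _∷ʳ_; foldr; filter; upTo)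
import Data.List.Properties as LP
open import Data.Product using (_,_)
open import Data.Sum using (_⊎_; inj₁; inj₂)
open import Data.Empty using (⊥-elim)
open import Relation.Nullary using (¬_)
open import Relation.Binary.PropositionalEquality
  using (refl; sym; trans; cong; cong₂; _→-setoid_; module ≡-Reasoning)
import Relation.Binary.Reasoning.Setoid as SetoidReasoning

ι : ℕ → ℚ
ι n = + n / 1

fromℚᵘ-+ : ∀ p q → fromℚᵘ (p U.+ q) ≡ fromℚᵘ p + fromℚᵘ q
fromℚᵘ-+ p q = toℚᵘ-injective (begin
  toℚᵘ (fromℚᵘ (p U.+ q))              ≈⟨ toℚᵘ-fromℚᵘ (p U.+ q) ⟩
  p U.+ q                              ≈⟨ UP.+-cong (UP.≃-sym (toℚᵘ-fromℚᵘ p)) (UP.≃-sym (toℚᵘ-fromℚᵘ q)) ⟩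
  toℚᵘ (fromℚᵘ p) U.+ toℚᵘ (fromℚᵘ q)  ≈⟨ UP.≃-sym (toℚᵘ-homo-+ (fromℚᵘ p) (fromℚᵘ q)) ⟩
  toℚᵘ (fromℚᵘ p + fromℚᵘ q)           ∎)
  where open UP.≃-Reasoning

fromℚᵘ-* : ∀ p q → fromℚᵘ (p U.* q) ≡ fromℚᵘ p * fromℚᵘ q
fromℚᵘ-* p q = toℚᵘ-injective (begin
  toℚᵘ (fromℚᵘ (p U.* q))              ≈⟨ toℚᵘ-fromℚᵘ (p U.* q) ⟩
  p U.* q                              ≈⟨ UP.*-cong (UP.≃-sym (toℚᵘ-fromℚᵘ p)) (UP.≃-sym (toℚᵘ-fromℚᵘ q)) ⟩
  toℚᵘ (fromℚᵘ p) U.* toℚᵘ (fromℚᵘ q)  ≈⟨ UP.≃-sym (toℚᵘ-homo-* (fromℚᵘ p) (fromℚᵘ q)) ⟩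
  toℚᵘ (fromℚᵘ p * fromℚᵘ q)           ∎)
  where open UP.≃-Reasoning

ι-suc : ∀ n → ι (suc n) ≡ 1ℚ + ι n
ι-suc n = trans (fromℚᵘ-cong {U.mkℚᵘ (+ suc n) 0} {U.mkℚᵘ (+ 1) 0 U.+ U.mkℚᵘ (+ n) 0} (U.*≡* cross-multiplied))
                (fromℚᵘ-+ (U.mkℚᵘ (+ 1) 0) (U.mkℚᵘ (+ n) 0))
  where
  open ℤ-Solver.+-*-Solver
  cross-multiplied : (+ 1 ℤ.+ + n) ℤ.* + 1 ≡ (+ 1 ℤ.* + 1 ℤ.+ + n ℤ.* + 1) ℤ.* + 1
  cross-multiplied = solve 1 (λ x → (con (+ 1) :+ x) :* con (+ 1)
                                  := (con (+ 1) :* con (+ 1) :+ x :* con (+ 1)) :* con (+ 1)) refl (+ n)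

/-self : ∀ a .{{_ : ℕ.NonZero a}} → + a / a ≡ 1ℚ
/-self (suc a) = fromℚᵘ-cong {U.mkℚᵘ (+ suc a) a} {U.mkℚᵘ (+ 1) 0} (U.*≡* (ℤP.*-comm (+ suc a) (+ 1)))

-- a / ((c+1) b) · (c+1) = a / b: the identity (j+1) · n!/(j+1)! = n!/j!.
/-*-cancel : ∀ a c b .{{_ : ℕ.NonZero b}} .{{_ : ℕ.NonZero (suc c ℕ.* b)}} →
             (+ a / (suc c ℕ.* b)) * ι (suc c) ≡ + a / b
/-*-cancel a c (suc b) = begin
  (+ a / (suc c ℕ.* suc b)) * ι (suc c)   ≡⟨ sym (fromℚᵘ-* (+ a U./ (suc c ℕ.* suc b)) (+ suc c U./ 1)) ⟩
  fromℚᵘ ((+ a U./ (suc c ℕ.* suc b)) U.* (+ suc c U./ 1))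
    ≡⟨ fromℚᵘ-cong (UP.≃-trans (UP.≃-reflexive (UP./-cong (ℤP.*-comm (+ a) (+ suc c))
                                                         (ℕP.*-identityʳ (suc c ℕ.* suc b))))
                               (UP.*-cancelˡ-/ (suc c) {+ a} {suc b})) ⟩
  + a / suc b                              ∎
  where open ≡-Reasoning

-- x + y·0 = x, the shape in which vanishing higher coefficients appear.
x+y*0≡x : ∀ x y → x + y * 0ℚ ≡ x
x+y*0≡x x y = trans (cong (_+_ x) (*-zeroʳ y)) (+-identityʳ x)

0ₚ : Poly
0ₚ _ = 0ℚ

scale : ℚ → Poly → Poly
scale c p i = c * p i

module ≈ₚ-Reasoning = SetoidReasoning (ℕ →-setoid ℚ)

private
  variable
    p p′ q q′ : Poly

≈ₚ-refl : p ≈ₚ p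
≈ₚ-refl i = refl

≈ₚ-sym : p ≈ₚ q → q ≈ₚ p
≈ₚ-sym h i = sym (h i)

≈ₚ-trans : p ≈ₚ q → q ≈ₚ p′ → p ≈ₚ p′
≈ₚ-trans h g i = trans (h i) (g i)

⊕-cong : p ≈ₚ p′ → q ≈ₚ q′ → (p ⊕ q) ≈ₚ (p′ ⊕ q′)
⊕-cong h g i = cong₂ _+_ (h i) (g i)

mulT-cong : p ≈ₚ q → mulT p ≈ₚ mulT q
mulT-cong h zero    = refl
mulT-cong h (suc i) = h i

deriv-cong : p ≈ₚ q → deriv p ≈ₚ deriv q
deriv-cong h i = cong (ι (suc i) *_) (h (suc i))

scale-cong : ∀ {c d : ℚ} → c ≡ d → p ≈ₚ q → scale c p ≈ₚ scale d q
scale-cong c≡d h i = cong₂ _*_ c≡d (h i)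

⊕-identityˡ : (0ₚ ⊕ p) ≈ₚ p
⊕-identityˡ {p} i = +-identityˡ (p i)

⊕-identityʳ : (p ⊕ 0ₚ) ≈ₚ p
⊕-identityʳ {p} i = +-identityʳ (p i)

⊕-assoc : ∀ p q p′ → ((p ⊕ q) ⊕ p′) ≈ₚ (p ⊕ (q ⊕ p′))
⊕-assoc p q p′ i = +-assoc (p i) (q i) (p′ i)

⊕-comm : ∀ p q → (p ⊕ q) ≈ₚ (q ⊕ p)
⊕-comm p q i = +-comm (p i) (q i)

scale-one : scale 1ℚ p ≈ₚ p
scale-one {p} i = *-identityˡ (p i)

scale-scale : ∀ c d p → scale c (scale d p) ≈ₚ scale (c * d) p
scale-scale c d p i = sym (*-assoc c d (p i))

scale-⊕ : ∀ c p q → scale c (p ⊕ q) ≈ₚ (scale c p ⊕ scale c q)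
scale-⊕ c p q i = *-distribˡ-+ c (p i) (q i)

⊕-scale : ∀ c p → (p ⊕ scale c p) ≈ₚ scale (1ℚ + c) p
⊕-scale c p i = solve 2 (λ c x → x :+ c :* x := (con 1ℚ :+ c) :* x) refl c (p i)
  where open ℚ-Solver.+-*-Solver

mulT-scale : ∀ c p → mulT (scale c p) ≈ₚ scale c (mulT p)
mulT-scale c p zero    = sym (*-zeroʳ c)
mulT-scale c p (suc i) = refl

deriv-⊕ : ∀ p q → deriv (p ⊕ q) ≈ₚ (deriv p ⊕ deriv q)
deriv-⊕ p q i = *-distribˡ-+ (ι (suc i)) (p (suc i)) (q (suc i))

deriv-scale : ∀ c p → deriv (scale c p) ≈ₚ scale c (deriv p)
deriv-scale c p i = solve 3 (λ a c x → a :* (c :* x) := c :* (a :* x)) refl (ι (suc i)) c (p (suc i))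
  where open ℚ-Solver.+-*-Solver

deriv-one : deriv one ≈ₚ 0ₚ
deriv-one i = *-zeroʳ (ι (suc i))

deriv-mulT : ∀ p → deriv (mulT p) ≈ₚ (p ⊕ mulT (deriv p))
deriv-mulT p zero    = trans (*-identityˡ (p 0)) (sym (+-identityʳ (p 0)))
deriv-mulT p (suc i) = begin
  ι (suc (suc i)) * p (suc i)           ≡⟨ cong (_* p (suc i)) (ι-suc (suc i)) ⟩
  (1ℚ + ι (suc i)) * p (suc i)          ≡⟨ sym (⊕-scale (ι (suc i)) p (suc i)) ⟩
  p (suc i) + ι (suc i) * p (suc i)     ∎
  where open ≡-Reasoning

-- P_j is an Appell sequence: P_{j+1}' = (j+1) P_j.  The base case is
-- P_1 = t; the step differentiates P_{j+2} = t P_{j+1} + P_{j+1}' and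
-- recognises (j+1) (t P_j + P_j') = (j+1) P_{j+1}.
P-deriv : ∀ j → deriv (P (suc j)) ≈ₚ scale (ι (suc j)) (P j)
P-deriv zero zero    = refl
P-deriv zero (suc i) =
  solve 2 (λ a b → a :* (con 0ℚ :+ b :* con 0ℚ) := con 0ℚ) refl (ι (suc (suc i))) (ι (suc (suc (suc i))))
  where open ℚ-Solver.+-*-Solver
P-deriv (suc j) = begin
  deriv (mulT P₁ ⊕ deriv P₁)                               ≈⟨ deriv-⊕ (mulT P₁) (deriv P₁) ⟩
  deriv (mulT P₁) ⊕ deriv (deriv P₁)                       ≈⟨ ⊕-cong (deriv-mulT P₁) (deriv-cong (P-deriv j)) ⟩
  (P₁ ⊕ mulT (deriv P₁)) ⊕ deriv (scale c (P j))           ≈⟨ ⊕-assoc P₁ (mulT (deriv P₁)) (deriv (scale c (P j))) ⟩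
  P₁ ⊕ (mulT (deriv P₁) ⊕ deriv (scale c (P j)))
    ≈⟨ ⊕-cong (≈ₚ-refl {P₁}) (⊕-cong (≈ₚ-trans (mulT-cong (P-deriv j)) (mulT-scale c (P j))) (deriv-scale c (P j))) ⟩
  P₁ ⊕ (scale c (mulT (P j)) ⊕ scale c (deriv (P j)))      ≈⟨ ⊕-cong (≈ₚ-refl {P₁}) (≈ₚ-sym (scale-⊕ c (mulT (P j)) (deriv (P j)))) ⟩
  P₁ ⊕ scale c P₁                                           ≈⟨ ⊕-scale c P₁ ⟩
  scale (1ℚ + c) P₁                                         ≈⟨ scale-cong (sym (ι-suc (suc j))) ≈ₚ-refl ⟩
  scale (ι (suc (suc j))) P₁                                ∎
  where
  open ≈ₚ-Reasoning
  P₁ = P (suc j)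
  c  = ι (suc j)

P-degree : ∀ j i → j < i → P j i ≡ 0ℚ
P-degree zero    (suc i) _         = refl
P-degree (suc j) (suc i) (s≤s j<i) = begin
  P j i + ι (suc (suc i)) * P j (suc (suc i))
    ≡⟨ cong₂ (λ x y → x + ι (suc (suc i)) * y) (P-degree j i j<i) (P-degree j (suc (suc i)) j<i+2) ⟩
  0ℚ + ι (suc (suc i)) * 0ℚ
    ≡⟨ x+y*0≡x 0ℚ (ι (suc (suc i))) ⟩
  0ℚ ∎
  where
  open ≡-Reasoning
  j<i+2 = ℕP.m<n⇒m<1+n (ℕP.m<n⇒m<1+n j<i)

P-monic : ∀ j → P j j ≡ 1ℚ
P-monic zero    = refl
P-monic (suc j) = begin
  P j j + ι (suc (suc j)) * P j (suc (suc j))  ≡⟨ cong₂ (λ x y → x + ι (suc (suc j)) * y) (P-monic j) (P-degree j (suc (suc j)) j<j+2) ⟩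
  1ℚ + ι (suc (suc j)) * 0ℚ                    ≡⟨ x+y*0≡x 1ℚ (ι (suc (suc j))) ⟩
  1ℚ                                           ∎
  where
  open ≡-Reasoning
  j<j+2 = ℕP.m<n⇒m<1+n (ℕP.n<1+n j)

term : (ℕ → ℚ) → ℕ → Poly
term β j = scale (β j) (P j)

-- The combination over a list of indices; combJ k β is combOver (Jlist k) β.
combOver : List ℕ → (ℕ → ℚ) → Poly
combOver xs β i = foldr (λ j acc → term β j i + acc) 0ℚ xs

combOver-singleton : ∀ j β → combOver [ j ] β ≈ₚ term β j
combOver-singleton j β i = +-identityʳ (term β j i)

combOver-++ : ∀ xs ys β → combOver (xs ++ ys) β ≈ₚ (combOver xs β ⊕ combOver ys β)
combOver-++ []       ys β i = sym (+-identityˡ (combOver ys β i))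
combOver-++ (x ∷ xs) ys β i = trans (cong (_+_ (term β x i)) (combOver-++ xs ys β i))
                                    (sym (+-assoc (term β x i) (combOver xs β i) (combOver ys β i)))

combOver-cong : ∀ xs {β γ : ℕ → ℚ} → (∀ j → β j ≡ γ j) → combOver xs β ≈ₚ combOver xs γ
combOver-cong []       h i = refl
combOver-cong (x ∷ xs) h i = cong₂ (λ b acc → b * P x i + acc) (h x) (combOver-cong xs h i)

parity-flip : ∀ k → ¬ (suc k % 2 ≡ k % 2)
parity-flip zero    ()
parity-flip (suc k) eq = parity-flip k (sym eq)

Jlist-step : ∀ k → Jlist (suc (suc k)) ≡ Jlist k ++ [ suc (suc k) ]
Jlist-step k = begin
  filter sameParity (upTo (suc (suc (suc k))))
    ≡⟨ cong (filter sameParity) (sym (trans (cong (_∷ʳ suc (suc k)) (LP.upTo-∷ʳ (suc k))) (LP.upTo-∷ʳ (suc (suc k))))) ⟩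
  filter sameParity ((upTo (suc k) ++ [ suc k ]) ++ [ suc (suc k) ])
    ≡⟨ LP.filter-++ sameParity (upTo (suc k) ++ [ suc k ]) [ suc (suc k) ] ⟩
  filter sameParity (upTo (suc k) ++ [ suc k ]) ++ filter sameParity [ suc (suc k) ]
    ≡⟨ cong₂ _++_ (LP.filter-++ sameParity (upTo (suc k)) [ suc k ]) (LP.filter-accept sameParity {suc (suc k)} {[]} refl) ⟩
  (Jlist k ++ filter sameParity [ suc k ]) ++ [ suc (suc k) ]
    ≡⟨ cong (λ xs → (Jlist k ++ xs) ++ [ suc (suc k) ]) (LP.filter-reject sameParity {suc k} {[]} (parity-flip k)) ⟩
  (Jlist k ++ []) ++ [ suc (suc k) ]
    ≡⟨ cong (_++ [ suc (suc k) ]) (LP.++-identityʳ (Jlist k)) ⟩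
  Jlist k ++ [ suc (suc k) ]
    ∎
  where
  open ≡-Reasoning
  sameParity = λ j → j % 2 ℕ.≟ k % 2

combJ-step : ∀ k β → combJ (suc (suc k)) β ≈ₚ (combJ k β ⊕ term β (suc (suc k)))
combJ-step k β = begin
  combOver (Jlist (suc (suc k))) β                   ≡⟨ cong (λ xs → combOver xs β) (Jlist-step k) ⟩
  combOver (Jlist k ++ [ suc (suc k) ]) β            ≈⟨ combOver-++ (Jlist k) [ suc (suc k) ] β ⟩
  combJ k β ⊕ combOver [ suc (suc k) ] β             ≈⟨ ⊕-cong (≈ₚ-refl {combJ k β}) (combOver-singleton (suc (suc k)) β) ⟩
  combJ k β ⊕ term β (suc (suc k))                   ∎
  where open ≈ₚ-Reasoning

shift : (ℕ → ℚ) → ℕ → ℚ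
shift β j = β (suc j) * ι (suc j)

deriv-term : ∀ β j → deriv (term β (suc j)) ≈ₚ term (shift β) j
deriv-term β j = begin
  deriv (scale (β (suc j)) (P (suc j)))          ≈⟨ deriv-scale (β (suc j)) (P (suc j)) ⟩
  scale (β (suc j)) (deriv (P (suc j)))          ≈⟨ scale-cong {c = β (suc j)} refl (P-deriv j) ⟩
  scale (β (suc j)) (scale (ι (suc j)) (P j))    ≈⟨ scale-scale (β (suc j)) (ι (suc j)) (P j) ⟩
  scale (shift β j) (P j)                        ∎
  where open ≈ₚ-Reasoning

deriv-combJ-zero : ∀ β → deriv (combJ 0 β) ≈ₚ 0ₚ
deriv-combJ-zero β i = solve 2 (λ a b → a :* (b :* con 0ℚ :+ con 0ℚ) := con 0ℚ) refl (ι (suc i)) (β 0)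
  where open ℚ-Solver.+-*-Solver

deriv-combJ-step : ∀ k β → deriv (combJ (suc (suc k)) β) ≈ₚ (deriv (combJ k β) ⊕ term (shift β) (suc k))
deriv-combJ-step k β = begin
  deriv (combJ (suc (suc k)) β)                       ≈⟨ deriv-cong (combJ-step k β) ⟩
  deriv (combJ k β ⊕ term β (suc (suc k)))            ≈⟨ deriv-⊕ (combJ k β) (term β (suc (suc k))) ⟩
  deriv (combJ k β) ⊕ deriv (term β (suc (suc k)))    ≈⟨ ⊕-cong (≈ₚ-refl {deriv (combJ k β)}) (deriv-term β (suc k)) ⟩
  deriv (combJ k β) ⊕ term (shift β) (suc k)          ∎
  where open ≈ₚ-Reasoning

deriv-combJ : ∀ m β → deriv (combJ (suc m) β) ≈ₚ combJ m (shift β)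
deriv-combJ zero β = begin
  deriv (combJ 1 β)           ≈⟨ deriv-cong (combOver-singleton 1 β) ⟩
  deriv (term β 1)            ≈⟨ deriv-term β 0 ⟩
  term (shift β) 0            ≈⟨ ≈ₚ-sym (combOver-singleton 0 (shift β)) ⟩
  combJ 0 (shift β)           ∎
  where open ≈ₚ-Reasoning
deriv-combJ (suc zero) β = begin
  deriv (combJ 2 β)                        ≈⟨ deriv-combJ-step 0 β ⟩
  deriv (combJ 0 β) ⊕ term (shift β) 1     ≈⟨ ⊕-cong (deriv-combJ-zero β) (≈ₚ-refl {term (shift β) 1}) ⟩
  0ₚ ⊕ term (shift β) 1                    ≈⟨ ⊕-identityˡ ⟩
  term (shift β) 1                         ≈⟨ ≈ₚ-sym (combOver-singleton 1 (shift β)) ⟩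
  combJ 1 (shift β)                        ∎
  where open ≈ₚ-Reasoning
deriv-combJ (suc (suc m)) β = begin
  deriv (combJ (suc (suc (suc m))) β)                   ≈⟨ deriv-combJ-step (suc m) β ⟩
  deriv (combJ (suc m) β) ⊕ term (shift β) (suc (suc m)) ≈⟨ ⊕-cong (deriv-combJ m β) (≈ₚ-refl {term (shift β) (suc (suc m))}) ⟩
  combJ m (shift β) ⊕ term (shift β) (suc (suc m))       ≈⟨ ≈ₚ-sym (combJ-step m (shift β)) ⟩
  combJ (suc (suc m)) (shift β)                          ∎
  where open ≈ₚ-Reasoning

half-double : ∀ n → (n ℕ.+ n) ℕ./ 2 ≡ n
half-double n = begin
  (n ℕ.+ n) ℕ./ 2            ≡⟨ cong (λ m → (n ℕ.+ m) ℕ./ 2) (sym (ℕP.+-identityʳ n)) ⟩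
  (2 ℕ.* n) ℕ./ 2            ≡⟨ cong (ℕ._/ 2) (ℕP.*-comm 2 n) ⟩
  (n ℕ.* 2) ℕ./ 2            ≡⟨ m*n/n≡m n 2 ⟩
  n                          ∎
  where open ≡-Reasoning

βkj-diagonal : ∀ n → βkj n n ≡ 1ℚ
βkj-diagonal n = trans (cong (λ m → (+ (m !) / (n !)) {{n ℕP.!≢0}}) (half-double n))
                       (/-self (n !) {{n ℕP.!≢0}})

-- (j+1) β_{m+1,j+1} = β_{m+2,j}: both equal ((m+j+2)/2)! / j!.
βkj-shift : ∀ m j → shift (βkj (suc m)) j ≡ βkj (suc (suc m)) j
βkj-shift m j = trans (/-*-cancel (((suc m ℕ.+ suc j) ℕ./ 2) !) j (j !) {{j ℕP.!≢0}} {{suc j ℕP.!≢0}})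
                      (cong (λ s → (+ ((s ℕ./ 2) !) / (j !)) {{j ℕP.!≢0}}) (cong suc (ℕP.+-suc m j)))

P≈term : ∀ n → P n ≈ₚ term (βkj n) n
P≈term n = ≈ₚ-sym (≈ₚ-trans (scale-cong (βkj-diagonal n) (≈ₚ-refl {P n})) scale-one)

Q-expansion : ∀ k → Q k ≈ₚ combJ k (βkj k)
Q-expansion zero = ≈ₚ-trans (P≈term 0) (≈ₚ-sym (combOver-singleton 0 (βkj 0)))
Q-expansion (suc zero) = begin
  P 1 ⊕ deriv one               ≈⟨ ⊕-cong (≈ₚ-refl {P 1}) deriv-one ⟩
  P 1 ⊕ 0ₚ                      ≈⟨ ⊕-identityʳ ⟩
  P 1                           ≈⟨ P≈term 1 ⟩
  term (βkj 1) 1                ≈⟨ ≈ₚ-sym (combOver-singleton 1 (βkj 1)) ⟩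
  combJ 1 (βkj 1)               ∎
  where open ≈ₚ-Reasoning
Q-expansion (suc (suc m)) = begin
  P n ⊕ deriv (Q (suc m))                         ≈⟨ ⊕-cong (≈ₚ-refl {P n}) (deriv-cong (Q-expansion (suc m))) ⟩
  P n ⊕ deriv (combJ (suc m) (βkj (suc m)))       ≈⟨ ⊕-cong (≈ₚ-refl {P n}) (deriv-combJ m (βkj (suc m))) ⟩
  P n ⊕ combJ m (shift (βkj (suc m)))             ≈⟨ ⊕-cong (P≈term n) (combOver-cong (Jlist m) (βkj-shift m)) ⟩
  term (βkj n) n ⊕ combJ m (βkj n)                ≈⟨ ⊕-comm (term (βkj n) n) (combJ m (βkj n)) ⟩
  combJ m (βkj n) ⊕ term (βkj n) n                ≈⟨ ≈ₚ-sym (combJ-step m (βkj n)) ⟩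
  combJ n (βkj n)                                 ∎
  where
  open ≈ₚ-Reasoning
  n = suc (suc m)

term-degree : ∀ β j i → j < i → term β j i ≡ 0ℚ
term-degree β j i j<i = trans (cong (β j *_) (P-degree j i j<i)) (*-zeroʳ (β j))

term-leading : ∀ β j → term β j j ≡ β j
term-leading β j = trans (cong (β j *_) (P-monic j)) (*-identityʳ (β j))

combJ-degree : ∀ k β i → k < i → combJ k β i ≡ 0ℚ
combJ-degree zero          β i k<i = trans (combOver-singleton 0 β i) (term-degree β 0 i k<i)
combJ-degree (suc zero)    β i k<i = trans (combOver-singleton 1 β i) (term-degree β 1 i k<i)
combJ-degree (suc (suc k)) β i k<i = begin
  combJ (suc (suc k)) β i                     ≡⟨ combJ-step k β i ⟩
  combJ k β i + term β (suc (suc k)) i        ≡⟨ cong₂ _+_ (combJ-degree k β i (ℕP.<-trans (ℕP.m<n+m k (s≤s z≤n)) k<i))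
                                                          (term-degree β (suc (suc k)) i k<i) ⟩
  0ℚ + 0ℚ                                     ≡⟨ +-identityʳ 0ℚ ⟩
  0ℚ                                          ∎
  where open ≡-Reasoning

combJ-leading : ∀ k β → combJ k β k ≡ β k
combJ-leading zero          β = trans (combOver-singleton 0 β 0) (term-leading β 0)
combJ-leading (suc zero)    β = trans (combOver-singleton 1 β 1) (term-leading β 1)
combJ-leading (suc (suc k)) β = begin
  combJ (suc (suc k)) β n              ≡⟨ combJ-step k β n ⟩
  combJ k β n + term β n n             ≡⟨ cong₂ _+_ (combJ-degree k β n (ℕP.m<n+m k (s≤s z≤n))) (term-leading β n) ⟩
  0ℚ + β n                             ≡⟨ +-identityˡ (β n) ⟩
  β n                                  ∎
  where
  open ≡-Reasoning
  n = suc (suc k)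

combJ-top-unique : ∀ k (β γ : ℕ → ℚ) → combJ k β ≈ₚ combJ k γ → β k ≡ γ k
combJ-top-unique k β γ h = trans (sym (combJ-leading k β)) (trans (h k) (combJ-leading k γ))

combJ-drop-top : ∀ k (β γ : ℕ → ℚ) → combJ (suc (suc k)) β ≈ₚ combJ (suc (suc k)) γ → combJ k β ≈ₚ combJ k γ
combJ-drop-top k β γ h i = ∙-cancelʳ (term β n i) (combJ k β i) (combJ k γ i) (begin
  combJ k β i + term β n i        ≡⟨ sym (combJ-step k β i) ⟩
  combJ n β i                     ≡⟨ h i ⟩
  combJ n γ i                     ≡⟨ combJ-step k γ i ⟩
  combJ k γ i + term γ n i        ≡⟨ cong (λ b → combJ k γ i + b * P n i) (sym (combJ-top-unique n β γ h)) ⟩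
  combJ k γ i + term β n i        ∎)
  where
  open ≡-Reasoning
  n = suc (suc k)

InJ-zero : ∀ {j} → InJ 0 j → j ≡ 0
InJ-zero (j≤0 , _) = ℕP.n≤0⇒n≡0 j≤0

InJ-one : ∀ {j} → InJ 1 j → j ≡ 1
InJ-one {zero}        (_ , ())
InJ-one {suc zero}    _ = refl
InJ-one {suc (suc j)} (s≤s () , _)

InJ-step : ∀ k {j} → InJ (suc (suc k)) j → j ≡ suc (suc k) ⊎ InJ k j
InJ-step k (j≤k+2 , same-parity) with ℕP.m≤n⇒m<n∨m≡n j≤k+2
... | inj₂ j≡k+2       = inj₁ j≡k+2
... | inj₁ (s≤s j≤k+1) with ℕP.m≤n⇒m<n∨m≡n j≤k+1
...   | inj₂ refl      = ⊥-elim (parity-flip k same-parity)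
...   | inj₁ (s≤s j≤k) = inj₂ (j≤k , same-parity)

combJ-unique : ∀ k (β γ : ℕ → ℚ) → combJ k β ≈ₚ combJ k γ → ∀ {j} → InJ k j → β j ≡ γ j
combJ-unique zero          β γ h j∈J rewrite InJ-zero j∈J = combJ-top-unique 0 β γ h
combJ-unique (suc zero)    β γ h j∈J rewrite InJ-one j∈J  = combJ-top-unique 1 β γ h
combJ-unique (suc (suc k)) β γ h j∈J with InJ-step k j∈J
... | inj₁ refl = combJ-top-unique (suc (suc k)) β γ h
... | inj₂ j∈Jk = combJ-unique k β γ (combJ-drop-top k β γ h) j∈Jk

proposition2 : (k : ℕ) →
    (Q k ≈ₚ combJ k (βkj k)) ×
    ((β : ℕ → ℚ) → Q k ≈ₚ combJ k β → (j : ℕ) → InJ k j → β j ≡ βkj k j)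
proposition2 k = Q-expansion k , uniqueness
  where
  uniqueness : (β : ℕ → ℚ) → Q k ≈ₚ combJ k β → (j : ℕ) → InJ k j → β j ≡ βkj k j
  uniqueness β Q≈β j j∈J = combJ-unique k β (βkj k) (≈ₚ-trans (≈ₚ-sym Q≈β) (Q-expansion k)) j∈J
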